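{- Let $P$ be a finite poset and let $w$ be a word in letters $t_j$. If the relation type determined by $w$ holds in $\mathcal{BK}_P$, then it also holds in $\mathcal{BK}_Q$ for every convex induced subposet $Q$ of $P$.
   Context: For an $n$-element poset $P$, a linear extension is a list $(p_1,\dots,p_n)$ of all elements with $p_a<_P p_b$ implying $a<b$; ${\mathcal{L}}(P)$ is the set of these. The Bender--Knuth move $t_i$ ($1\le i\le n-1$) acts on ${\mathcal{L}}(P)$ by swapping $p_i,p_{i+1}$ if incomparable and fixing the list otherwise; $\mathcal{BK}_P$ is the permutation group on ${\mathcal{L}}(P)$ they generate. For a word $w$ in letters $t_j$ and an integer $s$, let $w_s$ be the word obtained by replacing each $t_j$ by $t_{j+s}$. The relation type determined by $w$ holds in $\mathcal{BK}_P$ if $w_s=1$ (as a permutation of ${\mathcal{L}}(P)$) for every integer $s$ such that $1\le j+s\le |P|-1$ for all letters $t_j$ occurring in $w$. An induced subposet $Q\subseteq P$ carries the restricted order; it is convex if $x,z\in Q$, $y\in P$, $x\le_P y\le_P z$ imply $y\in Q$. -}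

module Defs where

open import Level using (0ℓ)
open import Data.Nat as ℕ using (ℕ; zero; suc; _<?_)
open import Data.Nat.Properties using (<-trans; n<1+n)
open import Data.Integer as ℤ using (ℤ; +_; -[1+_]; _+_; _-_; _≤_)
open import Data.Fin as Fin using (Fin; fromℕ<)
open import Data.Vec using (Vec; lookup; _[_]≔_)
open import Data.List using (List; map; foldr)
open import Data.List.Relation.Unary.All using (All)
open import Data.Product using (_×_; ∃)
open import Data.Bool using (if_then_else_)
open import Relation.Nullary using (¬_; does)
open import Relation.Nullary.Decidable using (_⊎-dec_)
open import Relation.Binary using (Rel; Decidable; IsPartialOrder)
open import Relation.Binary.PropositionalEquality using (_≡_; _≢_)
open import Function.Bundles using (_⇔_)
open import Function.Definitions using (Injective)

record FinPoset : Set₁ where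
  field
    size           : ℕ
    _≼_            : Rel (Fin size) 0ℓ
    isPartialOrder : IsPartialOrder _≡_ _≼_
    _≼?_           : Decidable _≼_

  _≺_ : Rel (Fin size) 0ℓ
  x ≺ y = (x ≼ y) × (x ≢ y)

open FinPoset public

Word-of : FinPoset → Set
Word-of P = Vec (Fin (size P)) (size P)

-- Linear extension: a list of all elements (injective of length |P|, hence
-- a bijection onto P) with p_a <_P p_b implying a < b.
IsLinExt : (P : FinPoset) → Word-of P → Set
IsLinExt P v =
  (∀ a b → lookup v a ≡ lookup v b → a ≡ b) ×
  (∀ a b → _≺_ P (lookup v a) (lookup v b) → a Fin.< b)

-- Bender–Knuth move acting on the 0-indexed positions m, m+1
-- (i.e. the move t_{m+1}); identity if out of range.
bk₀ : (P : FinPoset) → ℕ → Word-of P → Word-of P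
bk₀ P m v with suc m <? size P
... | Relation.Nullary.no _ = v
... | Relation.Nullary.yes m+1<n =
  let i = fromℕ< (<-trans (n<1+n m) m+1<n)
      j = fromℕ< m+1<n
      x = lookup v i
      y = lookup v j
  in if does ((_≼?_ P x y) ⊎-dec (_≼?_ P y x))
       then v
       else ((v [ i ]≔ y) [ j ]≔ x)

-- The move t_k for an integer index k (identity when k is out of range 1..|P|-1;
-- such letters never occur in the statement below).
bk : (P : FinPoset) → ℤ → Word-of P → Word-of P
bk P (+ zero)  v = v
bk P (+ suc m) v = bk₀ P m v
bk P -[1+ _ ]  v = v

BKWord : Set
BKWord = List ℤ

-- Action of the word t_{j1} t_{j2} ... t_{jr} (as a composition of maps).
act : (P : FinPoset) → BKWord → Word-of P → Word-of P
act P w v = foldr (bk P) v w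

shift : ℤ → BKWord → BKWord
shift s w = map (λ j → j + s) w

RelationHolds : FinPoset → BKWord → Set
RelationHolds P w =
  ∀ (s : ℤ) →
  All (λ j → (+ 1 ≤ j + s) × (j + s ≤ + size P - + 1)) w →
  ∀ (v : Word-of P) → IsLinExt P v → act P (shift s w) v ≡ v

-- Q is (isomorphic to) an induced subposet of P via the embedding emb.
record InducedSubposet (Q P : FinPoset) : Set where
  field
    emb     : Fin (size Q) → Fin (size P)
    emb-inj : Injective _≡_ _≡_ emb
    induced : ∀ x y → (_≼_ Q x y ⇔ _≼_ P (emb x) (emb y))

open InducedSubposet public

IsConvex : {Q P : FinPoset} → InducedSubposet Q P → Set
IsConvex {Q} {P} e =
  ∀ (x z : Fin (size Q)) (y : Fin (size P)) →
  _≼_ P (emb e x) y → _≼_ P y (emb e z) → ∃ λ y' → emb e y' ≡ y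

-- Given a linear extension v of the convex subposet Q, list the elements of P as
-- follows: first those outside Q lying below some element of Q, then Q in the order
-- of v, then all others. Convexity makes this order compatible with P, so it yields
-- a linear extension of P in which Q occupies consecutive positions d+1, ..., d+|Q|.
-- On such a list the move t_{j+d} of BK_P acts on the block exactly as t_j of BK_Q
-- acts on v, so the relation w_{s+d} = 1 in BK_P forces w_s v = v.
module Submission where

open import Defs

open import Level using (0ℓ)
open import Data.Nat as ℕ using (ℕ; zero; suc; _+_; _≤_; _<_; z≤n; s≤s; _<?_)
import Data.Nat.Properties as ℕ
open import Data.Integer as ℤ using (ℤ; +_; +≤+)
import Data.Integer.Properties as ℤ
open import Data.Fin as Fin using (Fin; toℕ; fromℕ<)
import Data.Fin.Properties as Fin
open import Data.Fin.Permutation.Components using (transpose)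
open import Data.Vec using (Vec; lookup; tabulate; _[_]≔_)
open import Data.Vec.Properties
  using (lookup∘update; lookup∘update′; lookup∘tabulate; tabulate∘lookup; tabulate-cong)
open import Data.List using ([]; _∷_)
open import Data.List.Relation.Unary.All as All using (All; []; _∷_)
open import Data.Product using (Σ; ∃; _×_; _,_; proj₁; proj₂)
open import Data.Sum as Sum using (_⊎_; inj₁; inj₂; [_,_]′)
open import Data.Sum.Function.Propositional using (_⊎-⇔_)
open import Data.Bool using (true; false; if_then_else_)
open import Data.Unit using (tt)
open import Function using (_∘_; id)
open import Function.Bundles using (Equivalence)
open import Function.Definitions using (Injective; StrictlySurjective)
open import Relation.Nullary using (¬_; Dec; yes; no; does; contradiction)
open import Relation.Nullary.Decidable using (_⊎-dec_; _×-dec_; does-⇔)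
open import Relation.Unary using (Pred; Decidable; _⊆_; _∪_; ｛_｝)
open import Relation.Unary.Properties using (U?; _∪?_)
open import Relation.Binary using (IsPartialOrder; tri<; tri≈; tri>)
open import Relation.Binary.PropositionalEquality
  using (_≡_; _≢_; refl; sym; trans; cong; subst; subst₂; module ≡-Reasoning)

count : ∀ {m} {A : Pred (Fin m) 0ℓ} → Decidable A → ℕ
count {zero}  A? = 0
count {suc m} A? = (if does (A? Fin.zero) then suc else id) (count (A? ∘ Fin.suc))

count≤m : ∀ {m} {A : Pred (Fin m) 0ℓ} (A? : Decidable A) → count A? ≤ m
count≤m {zero}  _  = z≤n
count≤m {suc m} A? with A? Fin.zero
... | yes _ = s≤s (count≤m (A? ∘ Fin.suc))
... | no _  = ℕ.m≤n⇒m≤1+n (count≤m (A? ∘ Fin.suc))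

count-mono : ∀ {m} {A B : Pred (Fin m) 0ℓ} (A? : Decidable A) (B? : Decidable B) →
             A ⊆ B → count A? ≤ count B?
count-mono {zero}  _  _  _   = z≤n
count-mono {suc m} A? B? A⊆B with A? Fin.zero | B? Fin.zero
... | yes _ | yes _ = s≤s (count-mono (A? ∘ Fin.suc) (B? ∘ Fin.suc) A⊆B)
... | yes a | no ¬b = contradiction (A⊆B a) ¬b
... | no _  | yes _ = ℕ.m≤n⇒m≤1+n (count-mono (A? ∘ Fin.suc) (B? ∘ Fin.suc) A⊆B)
... | no _  | no _  = count-mono (A? ∘ Fin.suc) (B? ∘ Fin.suc) A⊆B

count-cong : ∀ {m} {A B : Pred (Fin m) 0ℓ} (A? : Decidable A) (B? : Decidable B) →
             A ⊆ B → B ⊆ A → count A? ≡ count B?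
count-cong A? B? A⊆B B⊆A = ℕ.≤-antisym (count-mono A? B? A⊆B) (count-mono B? A? B⊆A)

count-insert : ∀ {m} {A B : Pred (Fin m) 0ℓ} (A? : Decidable A) (B? : Decidable B) {x} →
               A ⊆ B → B ⊆ A ∪ ｛ x ｝ → ¬ A x → B x → count B? ≡ suc (count A?)
count-insert {suc m} A? B? {Fin.zero} A⊆B B⊆A+x ¬Ax Bx with A? Fin.zero | B? Fin.zero
... | yes Ax | _     = contradiction Ax ¬Ax
... | no _   | no ¬B = contradiction Bx ¬B
... | no _   | yes _ =
  cong suc (count-cong (B? ∘ Fin.suc) (A? ∘ Fin.suc) ([ id , (λ ()) ]′ ∘ B⊆A+x) A⊆B)
count-insert {suc m} A? B? {Fin.suc x} A⊆B B⊆A+x ¬Ax Bx with A? Fin.zero | B? Fin.zero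
... | yes _  | yes _  = cong suc (count-insert (A? ∘ Fin.suc) (B? ∘ Fin.suc) A⊆B
                          (Sum.map₂ Fin.suc-injective ∘ B⊆A+x) ¬Ax Bx)
... | yes A0 | no ¬B0 = contradiction (A⊆B A0) ¬B0
... | no ¬A0 | yes B0 = contradiction ([ id , (λ ()) ]′ (B⊆A+x B0)) ¬A0
... | no _   | no _   = count-insert (A? ∘ Fin.suc) (B? ∘ Fin.suc) A⊆B
                          (Sum.map₂ Fin.suc-injective ∘ B⊆A+x) ¬Ax Bx

count-strictMono : ∀ {m} {A B : Pred (Fin m) 0ℓ} (A? : Decidable A) (B? : Decidable B) {x} →
                   A ⊆ B → ¬ A x → B x → count A? < count B?
count-strictMono A? B? {x} A⊆B ¬Ax Bx = begin-strict
  count A?   <⟨ ℕ.≤-reflexive (sym (count-insert A? A+x? inj₁ id ¬Ax (inj₂ refl))) ⟩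
  count A+x? ≤⟨ count-mono A+x? B? [ A⊆B , (λ { refl → Bx }) ]′ ⟩
  count B?   ∎
  where
  open ℕ.≤-Reasoning
  A+x? : Decidable (_ ∪ ｛ x ｝)
  A+x? = A? ∪? (x Fin.≟_)

count<m : ∀ {m} {A : Pred (Fin m) 0ℓ} (A? : Decidable A) {x} → ¬ A x → count A? < m
count<m A? ¬Ax = ℕ.<-≤-trans (count-strictMono A? U? (λ _ → tt) ¬Ax tt) (count≤m U?)

count-<-suc : ∀ {m} (K : Fin m → ℕ) {x j} →
              K x ≡ j → (∀ {c} → K c ≡ j → x ≡ c) →
              count (λ c → K c <? suc j) ≡ suc (count (λ c → K c <? j))
count-<-suc K Kx≡j unique =
  count-insert (λ c → K c <? _) (λ c → K c <? _) ℕ.m<n⇒m<1+n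
    (Sum.map₂ unique ∘ ℕ.m<1+n⇒m<n∨m≡n)
    (ℕ.<-irrefl Kx≡j) (s≤s (ℕ.≤-reflexive Kx≡j))

injective⇒strictlySurjective : ∀ {m} {f : Fin m → Fin m} →
                               Injective _≡_ _≡_ f → StrictlySurjective _≡_ f
injective⇒strictlySurjective {suc m} {f} f-inj y with Fin.any? (λ x → f x Fin.≟ y)
... | yes hit  = hit
... | no miss = contradiction (Fin.injective⇒≤ squeeze-injective) ℕ.1+n≰n
  where
  y≢f : ∀ x → y ≢ f x
  y≢f x y≡fx = miss (x , sym y≡fx)
  squeeze-injective : Injective _≡_ _≡_ (λ x → Fin.punchOut (y≢f x))
  squeeze-injective {i} {j} = f-inj ∘ Fin.punchOut-injective (y≢f i) (y≢f j)

swap : ∀ {A : Set} {m} → Vec A m → Fin m → Fin m → Vec A m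
swap u i j = (u [ i ]≔ lookup u j) [ j ]≔ lookup u i

lookup-swap : ∀ {A : Set} {m} (u : Vec A m) (i j l : Fin m) →
              lookup (swap u i j) l ≡ lookup u (transpose i j l)
lookup-swap u i j l with l Fin.≟ i
... | yes refl with l Fin.≟ j
...   | yes refl = lookup∘update l (u [ l ]≔ lookup u l) (lookup u l)
...   | no l≢j   = trans (lookup∘update′ l≢j (u [ l ]≔ lookup u j) (lookup u l))
                         (lookup∘update l u (lookup u j))
lookup-swap u i j l | no l≢i with l Fin.≟ j
...   | yes refl = lookup∘update l (u [ i ]≔ lookup u l) (lookup u i)
...   | no l≢j   = trans (lookup∘update′ l≢j (u [ i ]≔ lookup u j) (lookup u i))
                         (lookup∘update′ l≢i u (lookup u j))

transpose-natural : ∀ {m k} {g : Fin k → Fin m} → Injective _≡_ _≡_ g →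
                    ∀ i j l → transpose (g i) (g j) (g l) ≡ g (transpose i j l)
transpose-natural {g = g} g-inj i j l with l Fin.≟ i | g l Fin.≟ g i
... | yes _    | yes _     = refl
... | yes refl | no gl≢gl  = contradiction refl gl≢gl
... | no l≢i   | yes gl≡gi = contradiction (g-inj gl≡gi) l≢i
... | no _     | no _ with l Fin.≟ j | g l Fin.≟ g j
...   | yes _    | yes _     = refl
...   | yes refl | no gl≢gl  = contradiction refl gl≢gl
...   | no l≢j   | yes gl≡gj = contradiction (g-inj gl≡gj) l≢j
...   | no _     | no _      = refl

linearExtension : (P : FinPoset) (r : Fin (size P) → Fin (size P)) → Injective _≡_ _≡_ r →
                  (∀ {a b} → _≺_ P a b → r a Fin.< r b) →
                  Σ (Word-of P) λ v → IsLinExt P v × (∀ a → lookup v (r a) ≡ a)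
linearExtension P r r-inj r-mono = v , (v-inj , v-mono) , v∘r
  where
  r-onto : StrictlySurjective _≡_ r
  r-onto = injective⇒strictlySurjective r-inj
  r⁻¹ : Fin (size P) → Fin (size P)
  r⁻¹ o = proj₁ (r-onto o)
  v : Word-of P
  v = tabulate r⁻¹
  r∘v : ∀ o → r (lookup v o) ≡ o
  r∘v o = trans (cong r (lookup∘tabulate r⁻¹ o)) (proj₂ (r-onto o))
  v-inj : ∀ a b → lookup v a ≡ lookup v b → a ≡ b
  v-inj a b va≡vb = trans (sym (r∘v a)) (trans (cong r va≡vb) (r∘v b))
  v-mono : ∀ a b → _≺_ P (lookup v a) (lookup v b) → a Fin.< b
  v-mono a b va≺vb = subst₂ Fin._<_ (r∘v a) (r∘v b) (r-mono va≺vb)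
  v∘r : ∀ a → lookup v (r a) ≡ a
  v∘r a = r-inj (r∘v (r a))

module KeyRanking {n : ℕ} (K : Fin n → ℕ) where

  _⊏_ : Fin n → Fin n → Set
  a ⊏ b = K a < K b ⊎ (K a ≡ K b × toℕ a < toℕ b)

  _⊏?_ : ∀ a b → Dec (a ⊏ b)
  a ⊏? b = (K a <? K b) ⊎-dec ((K a ℕ.≟ K b) ×-dec (toℕ a <? toℕ b))

  ⊏-trans : ∀ {a b c} → a ⊏ b → b ⊏ c → a ⊏ c
  ⊏-trans {a} {b} {c} = λ where
    (inj₁ ab)         (inj₁ bc)         → inj₁ (ℕ.<-trans ab bc)
    (inj₁ ab)         (inj₂ (b≈c , _))  → inj₁ (subst (K a <_) b≈c ab)
    (inj₂ (a≈b , _))  (inj₁ bc)         → inj₁ (subst (_< K c) (sym a≈b) bc)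
    (inj₂ (a≈b , ab)) (inj₂ (b≈c , bc)) → inj₂ (trans a≈b b≈c , ℕ.<-trans ab bc)

  ⊏-irrefl : ∀ {a} → ¬ a ⊏ a
  ⊏-irrefl (inj₁ aa)       = ℕ.<-irrefl refl aa
  ⊏-irrefl (inj₂ (_ , aa)) = ℕ.<-irrefl refl aa

  ⊏-connex : ∀ {a b} → a ≢ b → a ⊏ b ⊎ b ⊏ a
  ⊏-connex {a} {b} a≢b with ℕ.<-cmp (K a) (K b)
  ... | tri< Ka<Kb _ _ = inj₁ (inj₁ Ka<Kb)
  ... | tri> _ _ Kb<Ka = inj₂ (inj₁ Kb<Ka)
  ... | tri≈ _ Ka≡Kb _ with ℕ.<-cmp (toℕ a) (toℕ b)
  ...   | tri< a<b _ _ = inj₁ (inj₂ (Ka≡Kb , a<b))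
  ...   | tri> _ _ b<a = inj₂ (inj₂ (sym Ka≡Kb , b<a))
  ...   | tri≈ _ a≡b _ = contradiction (Fin.toℕ-injective a≡b) a≢b

  rank : Fin n → ℕ
  rank a = count (_⊏? a)

  rank-mono : ∀ {a b} → a ⊏ b → rank a < rank b
  rank-mono a⊏b =
    count-strictMono (_⊏? _) (_⊏? _) (λ c⊏a → ⊏-trans c⊏a a⊏b) ⊏-irrefl a⊏b

  rank-injective : Injective _≡_ _≡_ rank
  rank-injective {a} {b} ra≡rb with a Fin.≟ b
  ... | yes a≡b = a≡b
  ... | no a≢b with ⊏-connex a≢b
  ...   | inj₁ a⊏b = contradiction ra≡rb (ℕ.<⇒≢ (rank-mono a⊏b))
  ...   | inj₂ b⊏a = contradiction (sym ra≡rb) (ℕ.<⇒≢ (rank-mono b⊏a))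

  rank-uniqueKey : ∀ {x} → (∀ {c} → K c ≡ K x → c ≡ x) →
                   rank x ≡ count (λ c → K c <? K x)
  rank-uniqueKey {x} unique = count-cong (_⊏? x) (λ c → K c <? K x) strict inj₁
    where
    strict : ∀ {c} → c ⊏ x → K c < K x
    strict (inj₁ Kc<Kx)         = Kc<Kx
    strict (inj₂ (Kc≡Kx , c<x)) = contradiction (cong toℕ (unique Kc≡Kx)) (ℕ.<⇒≢ c<x)

  rankFin : Fin n → Fin n
  rankFin a = fromℕ< (count<m (_⊏? a) ⊏-irrefl)

  toℕ-rankFin : ∀ a → toℕ (rankFin a) ≡ rank a
  toℕ-rankFin a = Fin.toℕ-fromℕ< _

  rankFin-injective : Injective _≡_ _≡_ rankFin
  rankFin-injective {a} {b} eq =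
    rank-injective (trans (sym (toℕ-rankFin a)) (trans (cong toℕ eq) (toℕ-rankFin b)))

  rankFin-mono : ∀ {a b} → a ⊏ b → rankFin a Fin.< rankFin b
  rankFin-mono {a} {b} a⊏b =
    subst₂ _<_ (sym (toℕ-rankFin a)) (sym (toℕ-rankFin b)) (rank-mono a⊏b)

comparable? : (P : FinPoset) (x y : Fin (size P)) → Dec (_≼_ P x y ⊎ _≼_ P y x)
comparable? P x y = _≼?_ P x y ⊎-dec _≼?_ P y x

module _ {P Q : FinPoset} (e : InducedSubposet Q P) where

  ≺-reflect : ∀ {x y} → _≺_ P (emb e x) (emb e y) → _≺_ Q x y
  ≺-reflect {x} {y} (ex≼ey , ex≢ey) =
    Equivalence.from (induced e x y) ex≼ey , ex≢ey ∘ cong (emb e)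

  comparable-emb : ∀ x y →
                   does (comparable? Q x y) ≡ does (comparable? P (emb e x) (emb e y))
  comparable-emb x y = does-⇔ (induced e x y ⊎-⇔ induced e y x)
                              (comparable? Q x y) (comparable? P (emb e x) (emb e y))

InRange : ℕ → ℤ → Set
InRange n z = + 1 ℤ.≤ z × z ℤ.≤ + n ℤ.- + 1

inRange⇒< : ∀ {n m} → InRange n (+ suc m) → suc m < n
inRange⇒< {suc n} (_ , +≤+ m<n) = s≤s m<n

<⇒inRange : ∀ {n m} → suc m < n → InRange n (+ suc m)
<⇒inRange {suc n} (s≤s m<n) = +≤+ (s≤s z≤n) , +≤+ m<n

module Block {P Q : FinPoset} (e : InducedSubposet Q P)
             (d : ℕ) (fits : size Q + d ≤ size P) where

  offset : Fin (size Q) → Fin (size P)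
  offset i = fromℕ< (ℕ.<-≤-trans (ℕ.+-monoˡ-< d (Fin.toℕ<n i)) fits)

  toℕ-offset : ∀ i → toℕ (offset i) ≡ toℕ i + d
  toℕ-offset i = Fin.toℕ-fromℕ< _

  offset-injective : Injective _≡_ _≡_ offset
  offset-injective eq =
    Fin.toℕ-injective (ℕ.+-cancelʳ-≡ d _ _ (Fin.fromℕ<-injective _ _ _ _ eq))

  BlockAt : Word-of P → Word-of Q → Set
  BlockAt u' u = ∀ i → lookup u' (offset i) ≡ emb e (lookup u i)

  block-unique : ∀ {u' u₁ u₂} → BlockAt u' u₁ → BlockAt u' u₂ → u₁ ≡ u₂
  block-unique {u'} {u₁} {u₂} agree₁ agree₂ = begin
    u₁                   ≡⟨ tabulate∘lookup u₁ ⟨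
    tabulate (lookup u₁) ≡⟨ tabulate-cong same ⟩
    tabulate (lookup u₂) ≡⟨ tabulate∘lookup u₂ ⟩
    u₂                   ∎
    where
    open ≡-Reasoning
    same : ∀ i → lookup u₁ i ≡ lookup u₂ i
    same i = emb-inj e (trans (sym (agree₁ i)) (agree₂ i))

  swap-block : ∀ {u' u i j i' j'} → offset i ≡ i' → offset j ≡ j' →
               BlockAt u' u → BlockAt (swap u' i' j') (swap u i j)
  swap-block {u'} {u} {i} {j} refl refl agree l = begin
    lookup (swap u' (offset i) (offset j)) (offset l)
      ≡⟨ lookup-swap u' _ _ _ ⟩
    lookup u' (transpose (offset i) (offset j) (offset l))
      ≡⟨ cong (lookup u') (transpose-natural offset-injective i j l) ⟩
    lookup u' (offset (transpose i j l))
      ≡⟨ agree (transpose i j l) ⟩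
    emb e (lookup u (transpose i j l))
      ≡⟨ cong (emb e) (lookup-swap u i j l) ⟨
    emb e (lookup (swap u i j) l)
      ∎
    where open ≡-Reasoning

  if-block : ∀ {b b' u' u s' s} → b' ≡ b → BlockAt u' u → BlockAt s' s →
             BlockAt (if b' then u' else s') (if b then u else s)
  if-block {true}  refl agree _ = agree
  if-block {false} refl _ agree = agree

  bk₀-block : ∀ {m u' u} → suc m < size Q → BlockAt u' u →
              BlockAt (bk₀ P (m + d) u') (bk₀ Q m u)
  bk₀-block {m} {u'} {u} m+1<k agree with suc (m + d) <? size P | suc m <? size Q
  ... | no m+d+1≮n  | _          =
    contradiction (ℕ.<-≤-trans (ℕ.+-monoˡ-< d m+1<k) fits) m+d+1≮n
  ... | yes _       | no m+1≮k   = contradiction m+1<k m+1≮k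
  ... | yes m+d+1<n | yes m+1<k′ =
    if-block {u' = u'} {u} comparable-same agree (swap-block {u'} {u} offset-i offset-j agree)
    where
    i  = fromℕ< (ℕ.<-trans (ℕ.n<1+n m) m+1<k′)
    j  = fromℕ< m+1<k′
    i' = fromℕ< (ℕ.<-trans (ℕ.n<1+n (m + d)) m+d+1<n)
    j' = fromℕ< m+d+1<n
    offset-i : offset i ≡ i'
    offset-i = Fin.fromℕ<-cong _ _ (cong (_+ d) (Fin.toℕ-fromℕ< _)) _ _
    offset-j : offset j ≡ j'
    offset-j = Fin.fromℕ<-cong _ _ (cong (_+ d) (Fin.toℕ-fromℕ< _)) _ _
    comparable-same : does (comparable? P (lookup u' i') (lookup u' j')) ≡
                      does (comparable? Q (lookup u i) (lookup u j))
    comparable-same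
      rewrite sym offset-i | sym offset-j | agree i | agree j = sym (comparable-emb e _ _)

  bk-block : ∀ {z u' u} → InRange (size Q) z → BlockAt u' u →
             BlockAt (bk P (z ℤ.+ + d) u') (bk Q z u)
  bk-block {+ suc m} inRange = bk₀-block (inRange⇒< inRange)
  bk-block {+ zero}  (+≤+ () , _)
  bk-block {ℤ.-[1+ _ ]} (() , _)

  inRange-shift : ∀ {z} → InRange (size Q) z → InRange (size P) (z ℤ.+ + d)
  inRange-shift {+ suc m} inRange =
    <⇒inRange (ℕ.<-≤-trans (ℕ.+-monoˡ-< d (inRange⇒< inRange)) fits)
  inRange-shift {+ zero}  (+≤+ () , _)
  inRange-shift {ℤ.-[1+ _ ]} (() , _)

  act-block : ∀ {s} w {u' u} → All (λ j → InRange (size Q) (j ℤ.+ s)) w →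
              BlockAt u' u → BlockAt (act P (shift (s ℤ.+ + d) w) u') (act Q (shift s w) u)
  act-block []      []       agree = agree
  act-block {s} (j ∷ w) (r ∷ rs) agree rewrite sym (ℤ.+-assoc j s (+ d)) =
    bk-block r (act-block w rs agree)

  word-inRange : ∀ {s w} → All (λ j → InRange (size Q) (j ℤ.+ s)) w →
                 All (λ j → InRange (size P) (j ℤ.+ (s ℤ.+ + d))) w
  word-inRange {s} =
    All.map (λ {j} → subst (InRange (size P)) (ℤ.+-assoc j s (+ d)) ∘ inRange-shift)

  block-fixed : ∀ {w s u' u} → RelationHolds P w →
                All (λ j → InRange (size Q) (j ℤ.+ s)) w →
                IsLinExt P u' → BlockAt u' u → act Q (shift s w) u ≡ u
  block-fixed {w} {s} {u'} {u} holds inRange u'-linExt agree = block-unique {u'}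
    (subst (λ x → BlockAt x (act Q (shift s w) u)) fixed (act-block w inRange agree)) agree
    where
    fixed : act P (shift (s ℤ.+ + d) w) u' ≡ u'
    fixed = holds (s ℤ.+ + d) (word-inRange inRange) u' u'-linExt

module ConvexBlockExtension {P Q : FinPoset} (e : InducedSubposet Q P) (convex : IsConvex e)
                            (v : Word-of Q) (v-linExt : IsLinExt Q v) where

  private
    n : ℕ
    n = size P
    k : ℕ
    k = size Q
    module ≼ = IsPartialOrder (isPartialOrder P)

  index : Fin k → Fin k
  index x = proj₁ (injective⇒strictlySurjective (proj₁ v-linExt _ _) x)

  lookup∘index : ∀ x → lookup v (index x) ≡ x
  lookup∘index x = proj₂ (injective⇒strictlySurjective (proj₁ v-linExt _ _) x)

  index∘lookup : ∀ i → index (lookup v i) ≡ i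
  index∘lookup i = proj₁ v-linExt _ _ (lookup∘index (lookup v i))

  toℕ<n : ∀ (i : Fin k) → toℕ i < n
  toℕ<n i = ℕ.<-≤-trans (Fin.toℕ<n i) (Fin.injective⇒≤ (emb-inj e))

  downset : Fin n → ℕ
  downset a = count (λ y → _≼?_ P y a)

  downset-mono : ∀ {a b} → _≺_ P a b → downset a < downset b
  downset-mono {a} {b} (a≼b , a≢b) =
    count-strictMono (λ y → _≼?_ P y a) (λ y → _≼?_ P y b)
      (λ y≼a → ≼.trans y≼a a≼b) (λ b≼a → a≢b (≼.antisym a≼b b≼a)) ≼.refl

  data Region (a : Fin n) : Set where
    inside : ∀ x → emb e x ≡ a → Region a
    below  : ¬ (∃ λ x → emb e x ≡ a) → (∃ λ x → _≼_ P a (emb e x)) → Region a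
    other  : ¬ (∃ λ x → emb e x ≡ a) → ¬ (∃ λ x → _≼_ P a (emb e x)) → Region a

  region : ∀ a → Region a
  region a with Fin.any? (λ x → emb e x Fin.≟ a)
  ... | yes (x , ex≡a) = inside x ex≡a
  ... | no ∉Q with Fin.any? (λ x → _≼?_ P a (emb e x))
  ...   | yes ≼Q = below ∉Q ≼Q
  ...   | no ⋠Q  = other ∉Q ⋠Q

  keyIn : ∀ {a} → Region a → ℕ
  keyIn     (inside x _) = toℕ (index x) + suc n
  keyIn {a} (below _ _)  = downset a
  keyIn {a} (other _ _)  = n + suc n + downset a

  key : Fin n → ℕ
  key a = keyIn (region a)

  keyIn-mono : ∀ {a b} → _≺_ P a b → (ra : Region a) (rb : Region b) → keyIn ra < keyIn rb
  keyIn-mono a≺b (inside x refl) (inside y refl) =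
    ℕ.+-monoˡ-< (suc n) (proj₂ v-linExt _ _
      (subst₂ (_≺_ Q) (sym (lookup∘index x)) (sym (lookup∘index y)) (≺-reflect e a≺b)))
  keyIn-mono (a≼b , _) (inside x refl) (below ∉Q (z , b≼z)) =
    contradiction (convex x z _ a≼b b≼z) ∉Q
  keyIn-mono _ (inside x refl) (other _ _) =
    ℕ.<-≤-trans (ℕ.+-monoˡ-< (suc n) (toℕ<n (index x))) (ℕ.m≤m+n _ _)
  keyIn-mono _ (below _ _) (inside y refl) =
    ℕ.<-≤-trans (s≤s (count≤m _)) (ℕ.m≤n+m (suc n) _)
  keyIn-mono a≺b (below _ _) (below _ _) = downset-mono a≺b
  keyIn-mono _ (below _ _) (other _ _) =
    ℕ.<-≤-trans (s≤s (count≤m _)) (ℕ.≤-trans (ℕ.m≤n+m (suc n) n) (ℕ.m≤m+n _ _))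
  keyIn-mono (a≼b , _) (other _ ⋠Q) (inside y refl) = contradiction (y , a≼b) ⋠Q
  keyIn-mono (a≼b , _) (other _ ⋠Q) (below _ (z , b≼z)) =
    contradiction (z , ≼.trans a≼b b≼z) ⋠Q
  keyIn-mono a≺b (other _ _) (other _ _) = ℕ.+-monoʳ-< (n + suc n) (downset-mono a≺b)

  key-mono : ∀ {a b} → _≺_ P a b → key a < key b
  key-mono a≺b = keyIn-mono a≺b (region _) (region _)

  keyIn-emb : ∀ {y} (r : Region (emb e y)) → keyIn r ≡ toℕ (index y) + suc n
  keyIn-emb (inside x ex≡ey) = cong (λ z → toℕ (index z) + suc n) (emb-inj e ex≡ey)
  keyIn-emb (below ∉Q _)      = contradiction (_ , refl) ∉Q
  keyIn-emb (other ∉Q _)      = contradiction (_ , refl) ∉Q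

  key-lookup : ∀ i → key (emb e (lookup v i)) ≡ toℕ i + suc n
  key-lookup i = trans (keyIn-emb (region _)) (cong (λ z → toℕ z + suc n) (index∘lookup i))

  keyIn-inside : ∀ {c} i (r : Region c) → keyIn r ≡ toℕ i + suc n →
                 c ≡ emb e (lookup v i)
  keyIn-inside i (inside x refl) eq =
    cong (emb e) (trans (sym (lookup∘index x))
      (cong (lookup v) (Fin.toℕ-injective (ℕ.+-cancelʳ-≡ (suc n) _ _ eq))))
  keyIn-inside i (below _ _) eq =
    contradiction (subst (_≤ n) eq (count≤m _))
      (ℕ.<⇒≱ (ℕ.<-≤-trans (ℕ.n<1+n n) (ℕ.m≤n+m (suc n) (toℕ i))))
  keyIn-inside i (other _ _) eq =
    contradiction (ℕ.≤-trans (ℕ.m≤m+n (n + suc n) _) (ℕ.≤-reflexive eq))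
      (ℕ.<⇒≱ (ℕ.+-monoˡ-< (suc n) (toℕ<n i)))

  key-inside : ∀ {c} i → key c ≡ toℕ i + suc n → c ≡ emb e (lookup v i)
  key-inside i = keyIn-inside i (region _)

  open KeyRanking key

  -- the number of elements below Q: theirs are the only keys ≤ n
  d : ℕ
  d = count (λ c → key c <? suc n)

  count-key< : ∀ j → j ≤ k → count (λ c → key c <? j + suc n) ≡ j + d
  count-key< zero    _   = refl
  count-key< (suc j) j<k =
    trans (count-<-suc key key-x unique) (cong suc (count-key< j (ℕ.<⇒≤ j<k)))
    where
    i : Fin k
    i = fromℕ< j<k
    key-x : key (emb e (lookup v i)) ≡ j + suc n
    key-x = trans (key-lookup i) (cong (_+ suc n) (Fin.toℕ-fromℕ< j<k))
    unique : ∀ {c} → key c ≡ j + suc n → emb e (lookup v i) ≡ c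
    unique key-c = sym (key-inside i (trans (trans key-c (sym key-x)) (key-lookup i)))

  fits : k + d ≤ n
  fits = subst (_≤ n) (count-key< k ℕ.≤-refl) (count≤m _)

  rank-lookup : ∀ i → rank (emb e (lookup v i)) ≡ toℕ i + d
  rank-lookup i = begin
    rank (emb e (lookup v i))
      ≡⟨ rank-uniqueKey unique ⟩
    count (λ c → key c <? key (emb e (lookup v i)))
      ≡⟨ cong (λ m → count (λ c → key c <? m)) (key-lookup i) ⟩
    count (λ c → key c <? toℕ i + suc n)
      ≡⟨ count-key< (toℕ i) (ℕ.<⇒≤ (Fin.toℕ<n i)) ⟩
    toℕ i + d
      ∎
    where
    open ≡-Reasoning
    unique : ∀ {c} → key c ≡ key (emb e (lookup v i)) → c ≡ emb e (lookup v i)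
    unique key-c = key-inside i (trans key-c (key-lookup i))

  open Block e d fits

  ranked : Σ (Word-of P) λ v' → IsLinExt P v' × (∀ a → lookup v' (rankFin a) ≡ a)
  ranked = linearExtension P rankFin rankFin-injective
             (λ a≺b → rankFin-mono (inj₁ (key-mono a≺b)))

  v' : Word-of P
  v' = proj₁ ranked

  v'-linExt : IsLinExt P v'
  v'-linExt = proj₁ (proj₂ ranked)

  offset≡rankFin : ∀ i → offset i ≡ rankFin (emb e (lookup v i))
  offset≡rankFin i =
    Fin.toℕ-injective
      (trans (toℕ-offset i) (trans (sym (rank-lookup i)) (sym (toℕ-rankFin _))))

  v'-block : BlockAt v' v
  v'-block i = trans (cong (lookup v') (offset≡rankFin i)) (proj₂ (proj₂ ranked) _)

proposition3p5 : (P : FinPoset) (w : BKWord) → RelationHolds P w →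
    (Q : FinPoset) (e : InducedSubposet Q P) → IsConvex e →
    RelationHolds Q w
proposition3p5 P w holds Q e convex s inRange v v-linExt =
  block-fixed {u' = v'} holds inRange v'-linExt v'-block
  where
  open ConvexBlockExtension e convex v v-linExt
  open Block e d fits
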